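{- Let $r,J,K$ be positive integers and let $c_{js},d_{ks}\in\mathbb{Z}_{\ge 0}$ for $1\le j\le J$, $1\le k\le K$, $1\le s\le r$. Put $C_j(x)=\sum_{s=1}^r c_{js}x_s$ and $D_k(x)=\sum_{s=1}^r d_{ks}x_s$. Assume: no $C_j$ and no $D_k$ is identically zero; $C_j\neq D_k$ (as linear forms) for all $j,k$; for each $s$ some $c_{js}\neq 0$ or some $d_{ks}\neq 0$; and $\sum_{j=1}^J c_{js}=\sum_{k=1}^K d_{ks}$ for $s=1,\dots,r$. Consider the series $$F(t_1,\dots,t_r)=\sum_{m_1,\dots,m_r=0}^\infty \frac{\prod_{j=1}^J C_j(m_1,\dots,m_r)!}{\prod_{k=1}^K D_k(m_1,\dots,m_r)!}\,t_1^{m_1}\cdots t_r^{m_r}.$$ If $K\le J$, then $F$ does not have integral coefficients, i.e., there exist $m_1,\dots,m_r\in\mathbb{Z}_{\ge 0}$ with $\prod_j C_j(m)!/\prod_k D_k(m)!\notin\mathbb{Z}$. -}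

module Defs where

open import Data.Nat using (ℕ; zero; suc; _+_; _*_; _!)
open import Data.Fin using (Fin)
open import Data.Fin using () renaming (zero to fzero; suc to fsuc)

∑ : (n : ℕ) → (Fin n → ℕ) → ℕ
∑ zero    f = 0
∑ (suc n) f = f fzero + ∑ n (λ i → f (fsuc i))

∏ : (n : ℕ) → (Fin n → ℕ) → ℕ
∏ zero    f = 1
∏ (suc n) f = f fzero * ∏ n (λ i → f (fsuc i))

linForm : (r : ℕ) → (Fin r → ℕ) → (Fin r → ℕ) → ℕ
linForm r a x = ∑ r (λ s → a s * x s)

-- the coefficient  ∏_j C_j(m)! / ∏_k D_k(m)!  is an integer iff denominator divides numerator;
-- we record numerator and denominator separately
numer : (r J : ℕ) → (Fin J → Fin r → ℕ) → (Fin r → ℕ) → ℕ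
numer r J c m = ∏ J (λ j → (linForm r (c j) m) !)

denom : (r K : ℕ) → (Fin K → Fin r → ℕ) → (Fin r → ℕ) → ℕ
denom r K d m = ∏ K (λ k → (linForm r (d k) m) !)

{-# OPTIONS --safe #-}
-- Substituting m_s = t B^s, with B larger than every coefficient, turns C_j(m) and D_k(m) into
-- a_j t and b_k t, where the a_j, b_k are positive, Σ a = Σ b, and a_j ≠ b_k because base-B
-- digits are unique. Let M be the largest of the a_j, b_k and p > M² a prime; for n < p² the
-- exponent of p in n! is ⌊n/p⌋. If M = b_k, then t = ⌊p/M⌋ + 1 makes every a_j t < p ≤ b_k t,
-- so p divides the denominator but not the numerator. If M = a_j, take t′ = p − t instead:
-- ⌊vt/p⌋ + ⌊vt′/p⌋ = v − 1 for 0 < v ≤ M, so the exponent of p is Σ a − (J+1) − Σ ⌊a_j t/p⌋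
-- ≤ Σ a − J − 2 in the numerator but Σ b − (K+1) ≥ Σ a − J − 1 in the denominator.
module Submission where

open import Defs
open import Data.Nat using (ℕ; _≤_; NonZero)
open import Data.Nat.Divisibility using (_∣_)
open import Data.Fin using (Fin)
open import Data.Product using (Σ; ∃; _×_)
open import Data.Sum using (_⊎_)
open import Data.Sum using (inj₁; inj₂)
open import Relation.Nullary using (¬_)
open import Relation.Binary.PropositionalEquality using (_≡_; _≢_)

open import Data.Nat
open import Data.Nat.Properties
open import Data.Nat.Divisibility
open import Data.Nat.DivMod
open import Data.Nat.Primality
open import Data.Nat.Primality.Factorisation using (factorise)
open import Data.Nat.Solver using (module +-*-Solver)
open import Data.Fin using (toℕ) renaming (zero to fzero; suc to fsuc)
open import Data.Product using (_,_)
open import Data.List using ([]; _∷_)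
open import Data.List.Relation.Unary.All using (_∷_)
open import Data.Nat.ListAction using (product)
open import Function using (_∘_; flip)
open import Relation.Nullary using (yes; no; contradiction)
open import Relation.Binary.PropositionalEquality
  using (refl; sym; trans; cong; cong₂; subst; subst₂; module ≡-Reasoning)
import Algebra.Properties.Semiring.Sum +-*-semiring as Sum

open +-*-Solver

∑≡sum : ∀ n (f : Fin n → ℕ) → ∑ n f ≡ Sum.sum f
∑≡sum zero    f = refl
∑≡sum (suc n) f = cong (f fzero +_) (∑≡sum n (f ∘ fsuc))

∑-cong : ∀ n {f g : Fin n → ℕ} → (∀ i → f i ≡ g i) → ∑ n f ≡ ∑ n g
∑-cong n {f} {g} f≗g = trans (∑≡sum n f) (trans (Sum.sum-cong-≗ f≗g) (sym (∑≡sum n g)))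

∑-distrib-+ : ∀ n (f g : Fin n → ℕ) → ∑ n (λ i → f i + g i) ≡ ∑ n f + ∑ n g
∑-distrib-+ n f g = trans (∑≡sum n _)
  (trans (Sum.∑-distrib-+ f g) (sym (cong₂ _+_ (∑≡sum n f) (∑≡sum n g))))

∑-comm : ∀ m n (f : Fin m → Fin n → ℕ) →
  ∑ m (λ i → ∑ n (f i)) ≡ ∑ n (λ j → ∑ m (λ i → f i j))
∑-comm m n f = trans (∑∑≡sumsum m n f) (trans (Sum.∑-comm f) (sym (∑∑≡sumsum n m (flip f))))
  where
  ∑∑≡sumsum : ∀ m n (f : Fin m → Fin n → ℕ) → ∑ m (λ i → ∑ n (f i)) ≡ Sum.sum (λ i → Sum.sum (f i))
  ∑∑≡sumsum m n f = trans (∑-cong m (λ i → ∑≡sum n (f i))) (∑≡sum m _)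

∑-*ʳ : ∀ n x (f : Fin n → ℕ) → ∑ n f * x ≡ ∑ n (λ i → f i * x)
∑-*ʳ n x f = trans (cong (_* x) (∑≡sum n f)) (trans (Sum.*-distribʳ-sum x f) (sym (∑≡sum n _)))

∑-const : ∀ n x → ∑ n (λ _ → x) ≡ n * x
∑-const zero    x = refl
∑-const (suc n) x = cong (x +_) (∑-const n x)

∑-zero : ∀ n {f : Fin n → ℕ} → (∀ i → f i ≡ 0) → ∑ n f ≡ 0
∑-zero n f≗0 = trans (∑-cong n f≗0) (trans (∑-const n 0) (*-zeroʳ n))

term≤∑ : ∀ n (f : Fin n → ℕ) i → f i ≤ ∑ n f
term≤∑ (suc n) f fzero    = m≤m+n _ _
term≤∑ (suc n) f (fsuc i) = ≤-trans (term≤∑ n (f ∘ fsuc) i) (m≤n+m _ _)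

∏-cong : ∀ n {f g : Fin n → ℕ} → (∀ i → f i ≡ g i) → ∏ n f ≡ ∏ n g
∏-cong zero    f≗g = refl
∏-cong (suc n) f≗g = cong₂ _*_ (f≗g fzero) (∏-cong n (f≗g ∘ fsuc))

argmax : ∀ n (f : Fin (suc n) → ℕ) → ∃ λ i → ∀ j → f j ≤ f i
argmax zero    f = fzero , λ { fzero → ≤-refl }
argmax (suc n) f with argmax n (f ∘ fsuc)
... | i , f≤fi with f fzero ≤? f (fsuc i)
...   | yes f0≤fi = fsuc i , λ { fzero → f0≤fi ; (fsuc j) → f≤fi j }
...   | no  f0≰fi = fzero  , λ { fzero → ≤-refl ; (fsuc j) → ≤-trans (f≤fi j) (<⇒≤ (≰⇒> f0≰fi)) }

linForm-cong : ∀ r {x y : Fin r → ℕ} w → (∀ s → x s ≡ y s) → linForm r x w ≡ linForm r y w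
linForm-cong r w x≗y = ∑-cong r (λ s → cong (_* w s) (x≗y s))

linForm-scale : ∀ r (x w : Fin r → ℕ) t → linForm r x (λ s → t * w s) ≡ linForm r x w * t
linForm-scale r x w t = trans
  (∑-cong r (λ s → solve 3 (λ x t w → x :* (t :* w) := x :* w :* t) refl (x s) t (w s)))
  (sym (∑-*ʳ r t _))

∑-linForm : ∀ r n (c : Fin n → Fin r → ℕ) w →
  ∑ n (λ j → linForm r (c j) w) ≡ linForm r (λ s → ∑ n (λ j → c j s)) w
∑-linForm r n c w = trans (∑-comm n r (λ j s → c j s * w s))
  (∑-cong r (λ s → sym (∑-*ʳ n (w s) (λ j → c j s))))

linForm-pos : ∀ r (x w : Fin r → ℕ) {s} → x s ≢ 0 → 0 < w s → 0 < linForm r x w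
linForm-pos r x w {s} xs≢0 ws>0 = ≤-trans (*-mono-≤ (n≢0⇒n>0 xs≢0) ws>0) (term≤∑ r _ s)

powers : ∀ {r} → ℕ → Fin r → ℕ
powers B s = B ^ toℕ s

base-digits-unique : ∀ {B} .{{_ : NonZero B}} {x X y Y} → x < B → y < B →
  x + X * B ≡ y + Y * B → x ≡ y × X ≡ Y
base-digits-unique {B} {x} {X} {y} {Y} x<B y<B eq =
  trans (sym (%-digit {X = X} x<B)) (trans (cong (_% B) eq) (%-digit {X = Y} y<B)) ,
  trans (sym (/-digit {X = X} x<B)) (trans (cong (_/ B) eq) (/-digit {X = Y} y<B))
  where
  %-digit : ∀ {x X} → x < B → (x + X * B) % B ≡ x
  %-digit {x} {X} x<B = trans ([m+kn]%n≡m%n x X B) (m<n⇒m%n≡m x<B)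
  /-digit : ∀ {x X} → x < B → (x + X * B) / B ≡ X
  /-digit {x} {X} x<B = trans (+-distrib-/-∣ʳ x (n∣m*n X)) (cong₂ _+_ (m<n⇒m/n≡0 x<B) (m*n/n≡m X B))

linForm-powers-suc : ∀ r B (x : Fin (suc r) → ℕ) →
  linForm (suc r) x (powers B) ≡ x fzero + linForm r (x ∘ fsuc) (powers B) * B
linForm-powers-suc r B x = cong₂ _+_ (*-identityʳ (x fzero)) (linForm-scale r (x ∘ fsuc) (powers B) B)

linForm-powers-injective : ∀ r {B} .{{_ : NonZero B}} (x y : Fin r → ℕ) →
  (∀ s → x s < B) → (∀ s → y s < B) →
  linForm r x (powers B) ≡ linForm r y (powers B) → ∀ s → x s ≡ y s
linForm-powers-injective (suc r) {B} x y x<B y<B eq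
  with base-digits-unique (x<B fzero) (y<B fzero)
         (trans (sym (linForm-powers-suc r B x)) (trans eq (linForm-powers-suc r B y)))
... | x₀≡y₀ , tail-eq = λ
  { fzero    → x₀≡y₀
  ; (fsuc i) → linForm-powers-injective r (x ∘ fsuc) (y ∘ fsuc) (x<B ∘ fsuc) (y<B ∘ fsuc) tail-eq i
  }

∏!-linForm-scale : ∀ r n (c : Fin n → Fin r → ℕ) w t →
  ∏ n (λ j → linForm r (c j) (λ s → t * w s) !) ≡ ∏ n (λ j → (linForm r (c j) w * t) !)
∏!-linForm-scale r n c w t = ∏-cong n (λ j → cong _! (linForm-scale r (c j) w t))

prime-factor : ∀ n .{{_ : NonZero n}} → n ≢ 1 → ∃ λ p → Prime p × p ∣ n
prime-factor n n≢1 with factorise n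
... | record { factors = [] ; isFactorisation = n≡1 } = contradiction n≡1 n≢1
... | record { factors = p ∷ ps ; isFactorisation = n≡p*ps ; factorsPrime = prime[p] ∷ _ } =
  p , prime[p] , subst (p ∣_) (sym n≡p*ps) (m∣m*n (product ps))

n∣n! : ∀ n .{{_ : NonZero n}} → n ∣ n !
n∣n! (suc n) = m∣m*n (n !)

prime-above : ∀ N → ∃ λ p → Prime p × N < p
prime-above N with prime-factor (suc (N !)) (λ eq → <-irrefl (sym (suc-injective eq)) (1≤n! N))
... | p , prime[p] , p∣N!+1 with N <? p
...   | yes N<p = p , prime[p] , N<p
...   | no  N≮p = contradiction (subst Prime (∣1⇒≡1 p∣1) prime[p]) ¬prime[1]
  where
  instance _ = prime⇒nonZero prime[p]
  p∣1 : p ∣ 1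
  p∣1 = ∣m+n∣m⇒∣n (subst (p ∣_) (+-comm 1 (N !)) p∣N!+1) (∣-trans (n∣n! p) (m≤n⇒m!∣n! (≮⇒≥ N≮p)))

^-monoʳ-∣ : ∀ p {e f} → e ≤ f → p ^ e ∣ p ^ f
^-monoʳ-∣ p {e} e≤f with m≤n⇒∃[o]m+o≡n e≤f
... | k , refl = divides (p ^ k) (trans (^-distribˡ-+-* p e k) (*-comm (p ^ e) (p ^ k)))

infix 4 _^_∥_
record _^_∥_ (p e n : ℕ) : Set where
  constructor exactly
  field
    cofactor      : ℕ
    factorisation : n ≡ p ^ e * cofactor
    p∤cofactor    : ¬ p ∣ cofactor

module _ {p} (prime[p] : Prime p) where

  private instance _ = prime⇒nonZero prime[p]

  ∤-* : ∀ {m n} → ¬ p ∣ m → ¬ p ∣ n → ¬ p ∣ m * n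
  ∤-* p∤m p∤n p∣mn with euclidsLemma _ _ prime[p] p∣mn
  ... | inj₁ p∣m = p∤m p∣m
  ... | inj₂ p∣n = p∤n p∣n

  ∥-1 : p ^ 0 ∥ 1
  ∥-1 = exactly 1 refl λ p∣1 → ¬prime[1] (subst Prime (∣1⇒≡1 p∣1) prime[p])

  ∤⇒∥⁰ : ∀ {m} → ¬ p ∣ m → p ^ 0 ∥ m
  ∤⇒∥⁰ {m} p∤m = exactly m (sym (*-identityˡ m)) p∤m

  ∤⇒∥¹ : ∀ {m} → ¬ p ∣ m → p ^ 1 ∥ m * p
  ∤⇒∥¹ {m} p∤m = exactly m (trans (*-comm m p) (cong (_* m) (sym (*-identityʳ p)))) p∤m

  ∥-* : ∀ {e f m n} → p ^ e ∥ m → p ^ f ∥ n → p ^ (e + f) ∥ m * n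
  ∥-* {e} {f} (exactly u refl p∤u) (exactly v refl p∤v) = exactly (u * v) eq (∤-* p∤u p∤v)
    where
    eq : p ^ e * u * (p ^ f * v) ≡ p ^ (e + f) * (u * v)
    eq = trans (solve 4 (λ P Q u v → P :* u :* (Q :* v) := P :* Q :* (u :* v)) refl (p ^ e) (p ^ f) u v)
               (cong (_* (u * v)) (sym (^-distribˡ-+-* p e f)))

  ∥-∏ : ∀ n {f e : Fin n → ℕ} → (∀ i → p ^ e i ∥ f i) → p ^ ∑ n e ∥ ∏ n f
  ∥-∏ zero    _     = ∥-1
  ∥-∏ (suc n) ∥-f = ∥-* (∥-f fzero) (∥-∏ n (∥-f ∘ fsuc))

  ∥<∥⇒∤ : ∀ {e f m n} → p ^ e ∥ m → p ^ f ∥ n → e < f → ¬ n ∣ m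
  ∥<∥⇒∤ {e} {f} (exactly u refl p∤u) (exactly v refl _) e<f n∣m =
    p∤u (*-cancelˡ-∣ (p ^ e) {{m^n≢0 p e}} p^e*p∣p^e*u)
    where
    p^e*p∣p^e*u : p ^ e * p ∣ p ^ e * u
    p^e*p∣p^e*u = ∣-trans (subst (_∣ p ^ f) (*-comm p (p ^ e)) (^-monoʳ-∣ p e<f))
                          (∣-trans (m∣m*n v) n∣m)

-- Legendre's formula below p²: in (ρ + q p)! with digits q, ρ < p, only the factors p, 2p, …, qp
-- are divisible by p, each exactly once.
∥-!-digits : ∀ {p} → Prime p → ∀ q ρ → q < p → ρ < p → p ^ q ∥ (ρ + q * p) !
∥-!-digits {suc p′} prime[p] zero    zero    _   _   = ∥-1 prime[p]
∥-!-digits {suc p′} prime[p] (suc q) zero    q<p _   =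
  ∥-* prime[p] (∤⇒∥¹ prime[p] (>⇒∤ q<p)) (∥-!-digits prime[p] q p′ (<-trans (n<1+n q) q<p) ≤-refl)
∥-!-digits {suc p′} prime[p] q       (suc ρ) q<p ρ<p =
  ∥-* prime[p] (∤⇒∥⁰ prime[p] p∤ρ+qp) (∥-!-digits prime[p] q ρ q<p (<-trans (n<1+n ρ) ρ<p))
  where
  p∤ρ+qp : ¬ suc p′ ∣ suc ρ + q * suc p′
  p∤ρ+qp p∣ρ+qp = >⇒∤ ρ<p (∣m+n∣m⇒∣n (subst (suc p′ ∣_) (+-comm (suc ρ) _) p∣ρ+qp) (n∣m*n q))

module _ {p} (prime[p] : Prime p) where

  private instance _ = prime⇒nonZero prime[p]

  ∥-! : ∀ {n} → n < p * p → p ^ (n / p) ∥ n !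
  ∥-! {n} n<pp = subst (λ m → p ^ (n / p) ∥ m !) (sym (m≡m%n+[m/n]*n n p))
    (∥-!-digits prime[p] (n / p) (n % p) (m<n*o⇒m/o<n n<pp) (m%n<n n p))

  ∏!-∤ : ∀ {m n} (x : Fin m → ℕ) (y : Fin n → ℕ) → (∀ i → x i < p * p) → (∀ i → y i < p * p) →
    ∑ m (λ i → x i / p) < ∑ n (λ i → y i / p) → ¬ ∏ n (λ i → y i !) ∣ ∏ m (λ i → x i !)
  ∏!-∤ {m} {n} x y x<pp y<pp =
    ∥<∥⇒∤ prime[p] (∥-∏ prime[p] m (∥-! ∘ x<pp)) (∥-∏ prime[p] n (∥-! ∘ y<pp))

/-complement : ∀ {p} .{{_ : NonZero p}} x y a → ¬ p ∣ x → x + y ≡ a * p → x / p + y / p + 1 ≡ a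
/-complement {p} x y a p∤x x+y≡ap = trans (+-comm Q 1) (≤-antisym Q<a a≤1+Q)
  where
  Q R : ℕ
  Q = x / p + y / p
  R = x % p + y % p
  ap≡R+Qp : a * p ≡ R + Q * p
  ap≡R+Qp = trans (sym x+y≡ap) (trans (cong₂ _+_ (m≡m%n+[m/n]*n x p) (m≡m%n+[m/n]*n y p))
    (solve 5 (λ rx qx ry qy p → rx :+ qx :* p :+ (ry :+ qy :* p) := rx :+ ry :+ (qx :+ qy) :* p)
       refl (x % p) (x / p) (y % p) (y / p) p))
  0<R : 0 < R
  0<R = ≤-trans (n≢0⇒n>0 (p∤x ∘ m%n≡0⇒n∣m x p)) (m≤m+n (x % p) (y % p))
  Q<a : Q < a
  Q<a = *-cancelʳ-< p Q a (subst (Q * p <_) (sym ap≡R+Qp) (+-monoˡ-< (Q * p) 0<R))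
  a≤1+Q : a ≤ 1 + Q
  a≤1+Q = ≤-pred (*-cancelʳ-< p a (2 + Q) (subst₂ _<_ (sym ap≡R+Qp)
    (solve 2 (λ p Q → p :+ p :+ Q :* p := (con 2 :+ Q) :* p) refl p Q)
    (+-monoˡ-< (Q * p) (+-mono-< (m%n<n x p) (m%n<n y p)))))

-- t = ⌊p/M⌋ + 1 is the least t with M t > p.
module Threshold {p} (prime[p] : Prime p) (M : ℕ) .{{_ : NonZero M}} (M*M<p : M * M < p) where

  instance
    p-nonZero : NonZero p
    p-nonZero = prime⇒nonZero prime[p]

  t : ℕ
  t = suc (p / M)

  M≤p/M : M ≤ p / M
  M≤p/M = subst (_≤ p / M) (m*n/n≡m M M) (/-monoˡ-≤ M (<⇒≤ M*M<p))

  M<p : M < p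
  M<p = ≤-<-trans (m≤m*n M M) M*M<p

  below-threshold : ∀ {v} → v < M → v * t < p
  below-threshold {v} v<M = begin-strict
    v * suc (p / M)     ≡⟨ solve 2 (λ v q → v :* (con 1 :+ q) := v :* q :+ v) refl v (p / M) ⟩
    v * (p / M) + v     <⟨ +-monoʳ-< (v * (p / M)) (<-≤-trans v<M M≤p/M) ⟩
    v * (p / M) + p / M ≡⟨ solve 2 (λ v q → v :* q :+ q := q :* (con 1 :+ v)) refl v (p / M) ⟩
    p / M * suc v       ≤⟨ *-monoʳ-≤ (p / M) v<M ⟩
    p / M * M           ≤⟨ m/n*n≤m p M ⟩
    p                   ∎
    where open ≤-Reasoning

  above-threshold : p ≤ M * t
  above-threshold = begin
    p                    ≡⟨ m≡m%n+[m/n]*n p M ⟩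
    p % M + p / M * M    ≤⟨ +-monoˡ-≤ (p / M * M) (<⇒≤ (m%n<n p M)) ⟩
    M + p / M * M        ≡⟨ solve 2 (λ M q → M :+ q :* M := M :* (con 1 :+ q)) refl M (p / M) ⟩
    M * suc (p / M)      ∎
    where open ≤-Reasoning

  t<p : 2 ≤ M → t < p
  t<p 2≤M = begin-strict
    suc (p / M)    <⟨ +-monoˡ-< (p / M) (≤-trans 2≤M M≤p/M) ⟩
    p / M + p / M  ≡⟨ solve 1 (λ q → q :+ q := q :* con 2) refl (p / M) ⟩
    p / M * 2      ≤⟨ *-monoʳ-≤ (p / M) 2≤M ⟩
    p / M * M      ≤⟨ m/n*n≤m p M ⟩
    p              ∎
    where open ≤-Reasoning

  *<p*p : ∀ {v u} → v ≤ M → u ≤ p → v * u < p * p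
  *<p*p v≤M u≤p = ≤-<-trans (*-mono-≤ v≤M u≤p) (*-monoˡ-< p M<p)

  ∑-below-threshold : ∀ n (x : Fin n → ℕ) → (∀ i → x i < M) → ∑ n (λ i → x i * t / p) ≡ 0
  ∑-below-threshold n x x<M = ∑-zero n (λ i → m<n⇒m/n≡0 (below-threshold (x<M i)))

  ∑-above-threshold : ∀ n (x : Fin n → ℕ) i → M ≤ x i → 0 < ∑ n (λ i → x i * t / p)
  ∑-above-threshold n x i M≤xi =
    ≤-trans (m≥n⇒m/n>0 (≤-trans above-threshold (*-monoˡ-≤ t M≤xi))) (term≤∑ n (λ i → x i * t / p) i)

  ∑-complement : 2 ≤ M → ∀ n (x : Fin n → ℕ) → (∀ i → 0 < x i) → (∀ i → x i ≤ M) →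
    ∑ n (λ i → x i * t / p) + ∑ n (λ i → x i * (p ∸ t) / p) + n ≡ ∑ n x
  ∑-complement 2≤M n x x>0 x≤M = begin
    ∑ n (λ i → x i * t / p) + ∑ n (λ i → x i * (p ∸ t) / p) + n
      ≡⟨ cong₂ _+_ (∑-distrib-+ n _ _) (trans (∑-const n 1) (*-identityʳ n)) ⟨
    ∑ n (λ i → x i * t / p + x i * (p ∸ t) / p) + ∑ n (λ _ → 1)
      ≡⟨ ∑-distrib-+ n _ _ ⟨
    ∑ n (λ i → x i * t / p + x i * (p ∸ t) / p + 1)
      ≡⟨ ∑-cong n (λ i → complement (x>0 i) (x≤M i)) ⟩
    ∑ n x ∎
    where
    open ≡-Reasoning
    complement : ∀ {v} → 0 < v → v ≤ M → v * t / p + v * (p ∸ t) / p + 1 ≡ v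
    complement {v} v>0 v≤M = /-complement (v * t) (v * (p ∸ t)) v
      (∤-* prime[p] (>⇒∤ {{>-nonZero v>0}} (≤-<-trans v≤M M<p)) (>⇒∤ (t<p 2≤M)))
      (trans (sym (*-distribˡ-+ v t (p ∸ t))) (cong (v *_) (m+[n∸m]≡n (<⇒≤ (t<p 2≤M)))))

module OneVariable {J K : ℕ} (a : Fin (suc J) → ℕ) (b : Fin (suc K) → ℕ)
  (a>0 : ∀ j → 0 < a j) (b>0 : ∀ k → 0 < b k) (a≢b : ∀ j k → a j ≢ b k)
  (∑a≡∑b : ∑ (suc J) a ≡ ∑ (suc K) b) (K≤J : suc K ≤ suc J) where

  IntegralAt : ℕ → Set
  IntegralAt t = ∏ (suc K) (λ k → (b k * t) !) ∣ ∏ (suc J) (λ j → (a j * t) !)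

  data Peak : Set where
    numerator-peak   : ∀ j₀ → (∀ j → a j ≤ a j₀) → (∀ k → b k < a j₀) → Peak
    denominator-peak : ∀ k₀ → (∀ k → b k ≤ b k₀) → (∀ j → a j < b k₀) → Peak

  peak : Peak
  peak with argmax J a | argmax K b
  ... | j₀ , a≤aj₀ | k₀ , b≤bk₀ with a j₀ ≤? b k₀
  ...   | yes aj₀≤bk₀ = denominator-peak k₀ b≤bk₀ (λ j → ≤∧≢⇒< (≤-trans (a≤aj₀ j) aj₀≤bk₀) (a≢b j k₀))
  ...   | no  aj₀≰bk₀ = numerator-peak j₀ a≤aj₀ (λ k → ≤-<-trans (b≤bk₀ k) (≰⇒> aj₀≰bk₀))

  denominator-case : ∀ k₀ → (∀ k → b k ≤ b k₀) → (∀ j → a j < b k₀) → ∃ λ t → ¬ IntegralAt t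
  denominator-case k₀ b≤bk₀ a<bk₀ with prime-above (b k₀ * b k₀)
  ... | p , prime[p] , M*M<p = t , ∏!-∤ prime[p] _ _
          (λ j → *<p*p (<⇒≤ (a<bk₀ j)) t≤p) (λ k → *<p*p (b≤bk₀ k) t≤p)
          (subst (_< ∑ (suc K) (λ k → b k * t / p)) (sym (∑-below-threshold (suc J) a a<bk₀))
                 (∑-above-threshold (suc K) b k₀ ≤-refl))
    where
    instance _ = >-nonZero (b>0 k₀)
    open Threshold prime[p] (b k₀) M*M<p
    t≤p : t ≤ p
    t≤p = <⇒≤ (t<p (≤-<-trans (a>0 fzero) (a<bk₀ fzero)))

  numerator-case : ∀ j₀ → (∀ j → a j ≤ a j₀) → (∀ k → b k < a j₀) → ∃ λ t → ¬ IntegralAt t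
  numerator-case j₀ a≤aj₀ b<aj₀ with prime-above (a j₀ * a j₀)
  ... | p , prime[p] , M*M<p = t′ , ∏!-∤ prime[p] _ _
          (λ j → *<p*p (a≤aj₀ j) (m∸n≤m p t)) (λ k → *<p*p (<⇒≤ (b<aj₀ k)) (m∸n≤m p t))
          (+-cancelʳ-≤ (suc J) _ _ (begin
            suc (∑ (suc J) (λ j → a j * t′ / p)) + suc J
              ≤⟨ +-monoˡ-≤ (suc J) (+-monoˡ-≤ _ (∑-above-threshold (suc J) a j₀ ≤-refl)) ⟩
            ∑ (suc J) (λ j → a j * t / p) + ∑ (suc J) (λ j → a j * t′ / p) + suc J
              ≡⟨ ∑-complement 2≤M (suc J) a a>0 a≤aj₀ ⟩
            ∑ (suc J) a
              ≡⟨ ∑a≡∑b ⟩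
            ∑ (suc K) b
              ≡⟨ ∑-complement 2≤M (suc K) b b>0 (<⇒≤ ∘ b<aj₀) ⟨
            ∑ (suc K) (λ k → b k * t / p) + ∑ (suc K) (λ k → b k * t′ / p) + suc K
              ≡⟨ cong (λ z → z + ∑ (suc K) (λ k → b k * t′ / p) + suc K) (∑-below-threshold (suc K) b b<aj₀) ⟩
            ∑ (suc K) (λ k → b k * t′ / p) + suc K
              ≤⟨ +-monoʳ-≤ _ K≤J ⟩
            ∑ (suc K) (λ k → b k * t′ / p) + suc J ∎))
    where
    instance _ = >-nonZero (a>0 j₀)
    open Threshold prime[p] (a j₀) M*M<p
    open ≤-Reasoning
    t′ : ℕ
    t′ = p ∸ t
    2≤M : 2 ≤ a j₀
    2≤M = ≤-<-trans (b>0 fzero) (b<aj₀ fzero)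

  factorial-ratio-not-integral : ∃ λ t → ¬ IntegralAt t
  factorial-ratio-not-integral with peak
  ... | numerator-peak   j₀ a≤aj₀ b<aj₀ = numerator-case j₀ a≤aj₀ b<aj₀
  ... | denominator-peak k₀ b≤bk₀ a<bk₀ = denominator-case k₀ b≤bk₀ a<bk₀

corollary2p22 : (r J K : ℕ) → .{{NonZero r}} → .{{NonZero J}} → .{{NonZero K}} →
    (c : Fin J → Fin r → ℕ) → (d : Fin K → Fin r → ℕ) →
    (∀ j → ∃ λ s → c j s ≢ 0) →
    (∀ k → ∃ λ s → d k s ≢ 0) →
    (∀ j k → ¬ (∀ s → c j s ≡ d k s)) →
    (∀ s → (∃ λ j → c j s ≢ 0) ⊎ (∃ λ k → d k s ≢ 0)) →
    (∀ s → ∑ J (λ j → c j s) ≡ ∑ K (λ k → d k s)) →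
    K ≤ J →
    ∃ λ (m : Fin r → ℕ) → ¬ (denom r K d m ∣ numer r J c m)
corollary2p22 r J@(suc _) K@(suc _) c d c≢0 d≢0 c≢d _ ∑c≡∑d K≤J =
  let t , not-integral = OneVariable.factorial-ratio-not-integral a b a>0 b>0 a≢b ∑a≡∑b K≤J
  in (λ s → t * w s) ,
     subst₂ (λ D N → ¬ D ∣ N) (sym (∏!-linForm-scale r K d w t)) (sym (∏!-linForm-scale r J c w t)) not-integral
  where
  ∑c ∑d B : ℕ
  ∑c = ∑ J (λ j → ∑ r (c j))
  ∑d = ∑ K (λ k → ∑ r (d k))
  B = suc (∑c + ∑d)
  w : Fin r → ℕ
  w = powers B
  a : Fin J → ℕ
  a j = linForm r (c j) w
  b : Fin K → ℕ
  b k = linForm r (d k) w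
  c<B : ∀ j s → c j s < B
  c<B j s = s≤s (≤-trans (≤-trans (term≤∑ r (c j) s) (term≤∑ J (λ j → ∑ r (c j)) j)) (m≤m+n ∑c ∑d))
  d<B : ∀ k s → d k s < B
  d<B k s = s≤s (≤-trans (≤-trans (term≤∑ r (d k) s) (term≤∑ K (λ k → ∑ r (d k)) k)) (m≤n+m ∑d ∑c))
  a>0 : ∀ j → 0 < a j
  a>0 j = let s , cjs≢0 = c≢0 j in linForm-pos r (c j) w cjs≢0 (m^n>0 B (toℕ s))
  b>0 : ∀ k → 0 < b k
  b>0 k = let s , dks≢0 = d≢0 k in linForm-pos r (d k) w dks≢0 (m^n>0 B (toℕ s))
  a≢b : ∀ j k → a j ≢ b k
  a≢b j k = c≢d j k ∘ linForm-powers-injective r (c j) (d k) (c<B j) (d<B k)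
  ∑a≡∑b : ∑ J a ≡ ∑ K b
  ∑a≡∑b = trans (∑-linForm r J c w) (trans (linForm-cong r w ∑c≡∑d) (sym (∑-linForm r K d w)))
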